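{- Let $g\ge 4$ be an even integer and let $m>g-1$ be an odd integer not divisible by $g-1$. Let $G_{m,g}=\{g^j \bmod m : j=0,1,2,\dots\}\subseteq \mathbb{Z}_m$. If at least one of the residues $-1,-2,\dots,-(g-2)$ modulo $m$, or at least one of the residues $2,3,\dots,g-1$ modulo $m$, belongs to $G_{m,g}$, then $m$ is complete (with respect to $g$).
   Context: Fix an even integer $g\ge4$. For an odd integer $m\ge1$, an extreme cycle for the digit set $\{0,m\}$ is a finite set of distinct integers $\{x_0,\dots,x_{r-1}\}$ together with digits $l_0,\dots,l_{r-1}\in\{0,m\}$ such that $x_{j+1}=(x_j+l_j)/g$ for $0\le j\le r-2$ and $x_0=(x_{r-1}+l_{r-1})/g$. The cycle $\{0\}$ (with digit $0$) is the trivial extreme cycle. The number $m$ is complete if the only extreme cycle for $\{0,m\}$ is the trivial one, and incomplete otherwise. -}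

module Defs where

open import Data.Nat as ℕ using (ℕ; zero; suc)
open import Data.Fin using (Fin; zero; suc; fromℕ; inject₁)
open import Data.Integer using (ℤ; +_; _+_; _*_; _-_)
open import Data.Integer.Divisibility using (_∣_)
open import Data.Product using (Σ; ∃; _×_; _,_)
open import Data.Sum using (_⊎_)
open import Relation.Binary.PropositionalEquality using (_≡_)
open import Function.Definitions using (Injective)

csuc : ∀ {n} → Fin (suc n) → Fin (suc n)
csuc {zero}  zero    = zero
csuc {suc n} zero    = suc zero
csuc {suc n} (suc j) with csuc {n} j
... | zero   = zero
... | suc k  = suc (suc k)

IsDigit : ℕ → ℤ → Set
IsDigit m l = (l ≡ + 0) ⊎ (l ≡ + m)

-- An extreme cycle of length r = suc n for the digit set {0,m} in base g:
-- distinct integers x_0..x_{r-1} and digits l_j ∈ {0,m} with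
-- g * x_{j+1 mod r} = x_j + l_j  (equivalently x_{j+1} = (x_j + l_j)/g).
record ExtremeCycle (g m : ℕ) : Set where
  field
    n        : ℕ
    x        : Fin (suc n) → ℤ
    l        : Fin (suc n) → ℤ
    distinct : Injective _≡_ _≡_ x
    digits   : ∀ j → IsDigit m (l j)
    step     : ∀ j → + g * x (csuc j) ≡ x j + l j

Trivial : ∀ {g m} → ExtremeCycle g m → Set
Trivial C = ∀ j → ExtremeCycle.x C j ≡ + 0

Complete : ℕ → ℕ → Set
Complete g m = (C : ExtremeCycle g m) → Trivial C

InG : ℕ → ℕ → ℤ → Set
InG g m a = ∃ λ (j : ℕ) → (+ m) ∣ (+ (g ℕ.^ j) - a)

-- Write g = g₁ + 1. Evaluating the step g·x_{j+1} = x_j + l_j at a largest and at a smallest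
-- element of an extreme cycle gives 0 ≤ x_j and g₁·x_j ≤ m, strictly since g₁ ∤ m. Modulo m
-- the step reads x_j ≡ g·x_{j+1}, so walking backwards around the cycle, for every a ≡ g^t
-- and every j there is an i with x_i ≡ a·x_j. If x_j > 0, then for a = −k (1 ≤ k ≤ g − 2) the
-- number x_i + k·x_j, and for a = k (2 ≤ k ≤ g − 1) with x_j maximal the number k·x_j − x_i,
-- is a multiple of m lying strictly between 0 and m. Hence every x_j is 0.

module Submission where

open import Defs
open import Data.Nat using (ℕ; _≤_; _<_; _∸_)
open import Data.Nat.Divisibility using (_∣_)
open import Data.Integer using (+_; -_)
open import Data.Product using (Σ; ∃; _×_; _,_)
open import Data.Sum using (_⊎_)
open import Relation.Nullary using (¬_)

open import Data.Nat.Base as ℕ using (zero; suc; NonZero; _^_)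
import Data.Nat.Divisibility as ℕ
import Data.Nat.Properties as ℕ
open import Data.Integer.Base as ℤ using (ℤ; 0ℤ; +[1+_]; _+_; _*_; _-_)
import Data.Integer.Properties as ℤ
import Data.Integer.Divisibility.Signed as ℤ
open import Data.Integer.Tactic.RingSolver using (solve-∀)
open import Data.Fin.Base using (Fin; zero; suc; fromℕ; inject₁)
open import Data.List.Base using (allFin)
open import Data.List.Extrema ℤ.≤-totalOrder using (argmax; argmin; v≤f[argmax]⁺; f[argmin]≤v⁺)
open import Data.List.Membership.Propositional using (lose)
open import Data.List.Membership.Propositional.Properties using (∈-allFin)
open import Data.Sum using (inj₁; inj₂)
open import Relation.Binary.PropositionalEquality
import Relation.Binary.Reasoning.Base.Single as Single

csuc-inject₁ : ∀ {n} (k : Fin n) → csuc (inject₁ k) ≡ suc k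
csuc-inject₁ {suc n} zero    = refl
csuc-inject₁ {suc n} (suc k) rewrite csuc-inject₁ k = refl

csuc-fromℕ : ∀ n → csuc (fromℕ n) ≡ zero
csuc-fromℕ zero    = refl
csuc-fromℕ (suc n) rewrite csuc-fromℕ n = refl

csuc-surjective : ∀ {n} (i : Fin (suc n)) → ∃ λ j → csuc j ≡ i
csuc-surjective {n}     zero    = fromℕ n , csuc-fromℕ n
csuc-surjective {suc n} (suc k) = inject₁ k , csuc-inject₁ k

maximum-attained : ∀ {n} (f : Fin (suc n) → ℤ) → ∃ λ i → ∀ j → f j ℤ.≤ f i
maximum-attained f =
  argmax f zero (allFin _) ,
  λ j → v≤f[argmax]⁺ {f = f} zero (allFin _) (inj₂ (lose (∈-allFin j) ℤ.≤-refl))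

minimum-attained : ∀ {n} (f : Fin (suc n) → ℤ) → ∃ λ i → ∀ j → f i ℤ.≤ f j
minimum-attained f =
  argmin f zero (allFin _) ,
  λ j → f[argmin]≤v⁺ {f = f} zero (allFin _) (inj₂ (lose (∈-allFin j) ℤ.≤-refl))

+-cancelʳ-≤ : ∀ c {a b} → a + c ℤ.≤ b + c → a ℤ.≤ b
+-cancelʳ-≤ c {a} {b} a+c≤b+c = subst₂ ℤ._≤_ (cancel a c) (cancel b c) (ℤ.+-monoˡ-≤ (- c) a+c≤b+c)
  where
  cancel : ∀ a c → a + c - c ≡ a
  cancel = solve-∀

∣∧pos⇒≤ : ∀ {m d} → + m ℤ.∣ d → 0ℤ ℤ.< d → + m ℤ.≤ d
∣∧pos⇒≤ {d = +[1+ n ]} m∣d _          = ℤ.+≤+ (ℕ.∣⇒≤ (ℤ.∣⇒∣ᵤ m∣d))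
∣∧pos⇒≤ {d = + zero}   _   (ℤ.+<+ ())

infix 4 _≡_mod_

-- A record rather than a synonym, so that unification does not unfold a - b and lose a and b.
record _≡_mod_ (a b : ℤ) (m : ℕ) : Set where
  constructor ≡mod
  field
    m∣a-b : + m ℤ.∣ a - b

module _ {m : ℕ} where

  ≡⇒≡mod : ∀ {a b} → a ≡ b → a ≡ b mod m
  ≡⇒≡mod {a} refl = ≡mod (ℤ.divides 0ℤ (ℤ.+-inverseʳ a))

  ≡mod-sym : ∀ {a b} → a ≡ b mod m → b ≡ a mod m
  ≡mod-sym {a} {b} (≡mod m∣a-b) = ≡mod (subst (+ m ℤ.∣_) (negate a b) (ℤ.∣m⇒∣-m m∣a-b))
    where
    negate : ∀ a b → - (a - b) ≡ b - a
    negate = solve-∀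

  ≡mod-trans : ∀ {a b c} → a ≡ b mod m → b ≡ c mod m → a ≡ c mod m
  ≡mod-trans {a} {b} {c} (≡mod m∣a-b) (≡mod m∣b-c) =
    ≡mod (subst (+ m ℤ.∣_) (telescope a b c) (ℤ.∣m∣n⇒∣m+n m∣a-b m∣b-c))
    where
    telescope : ∀ a b c → (a - b) + (b - c) ≡ a - c
    telescope = solve-∀

  *-congˡ-≡mod : ∀ c {a b} → a ≡ b mod m → c * a ≡ c * b mod m
  *-congˡ-≡mod c {a} {b} (≡mod m∣a-b) = ≡mod (subst (+ m ℤ.∣_) (distrib c a b) (ℤ.∣n⇒∣m*n c m∣a-b))
    where
    distrib : ∀ c a b → c * (a - b) ≡ c * a - c * b
    distrib = solve-∀

  *-congʳ-≡mod : ∀ c {a b} → a ≡ b mod m → a * c ≡ b * c mod m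
  *-congʳ-≡mod c {a} {b} (≡mod m∣a-b) = ≡mod (subst (+ m ℤ.∣_) (distrib c a b) (ℤ.∣m⇒∣m*n c m∣a-b))
    where
    distrib : ∀ c a b → (a - b) * c ≡ a * c - b * c
    distrib = solve-∀

  +-multiple-≡mod : ∀ a {l} → + m ℤ.∣ l → a + l ≡ a mod m
  +-multiple-≡mod a {l} m∣l = ≡mod (subst (+ m ℤ.∣_) (cancel a l) m∣l)
    where
    cancel : ∀ a l → l ≡ (a + l) - a
    cancel = solve-∀

InG⇒≡mod : ∀ {g m} a → InG g m a → ∃ λ t → + (g ^ t) ≡ a mod m
InG⇒≡mod a (t , m∣g^t-a) = t , ≡mod (ℤ.∣ᵤ⇒∣ m∣g^t-a)

module ≡mod-Reasoning (m : ℕ) =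
  Single (λ a b → a ≡ b mod m) (≡⇒≡mod refl) (≡mod-trans {m})

IsDigit⇒0≤ : ∀ {m l} → IsDigit m l → 0ℤ ℤ.≤ l
IsDigit⇒0≤ (inj₁ refl) = ℤ.≤-refl
IsDigit⇒0≤ (inj₂ refl) = ℤ.+≤+ ℕ.z≤n

IsDigit⇒≤ : ∀ {m l} → IsDigit m l → l ℤ.≤ + m
IsDigit⇒≤ (inj₁ refl) = ℤ.+≤+ ℕ.z≤n
IsDigit⇒≤ (inj₂ refl) = ℤ.≤-refl

IsDigit⇒∣ : ∀ {m l} → IsDigit m l → + m ℤ.∣ l
IsDigit⇒∣ (inj₁ refl) = ℤ.divides 0ℤ refl
IsDigit⇒∣ (inj₂ refl) = ℤ.∣-refl

module _ {g₁ m : ℕ} (C : ExtremeCycle (suc g₁) m) where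
  open ExtremeCycle C

  step-to : ∀ i → ∃ λ p → + suc g₁ * x i ≡ x p + l p
  step-to i with csuc-surjective i
  ... | p , refl = p , step p

  +[1+g₁]*-split : ∀ a → + suc g₁ * a ≡ + g₁ * a + a
  +[1+g₁]*-split a = trans (cong (_* a) (ℤ.pos-+ 1 g₁)) (distrib (+ g₁) a)
    where
    distrib : ∀ b a → (+ 1 + b) * a ≡ b * a + a
    distrib = solve-∀

  g₁*x≤m : ∀ j → + g₁ * x j ℤ.≤ + m
  g₁*x≤m j with maximum-attained x
  ... | M , x≤x[M] with step-to M
  ... | p , stepₘ = ℤ.≤-trans (ℤ.*-monoˡ-≤-nonNeg (+ g₁) (x≤x[M] j)) (+-cancelʳ-≤ (x M) (begin
    + g₁ * x M + x M  ≡⟨ +[1+g₁]*-split (x M) ⟨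
    + suc g₁ * x M    ≡⟨ stepₘ ⟩
    x p + l p         ≤⟨ ℤ.+-mono-≤ (x≤x[M] p) (IsDigit⇒≤ (digits p)) ⟩
    x M + + m         ≡⟨ ℤ.+-comm (x M) (+ m) ⟩
    + m + x M         ∎))
    where open ℤ.≤-Reasoning

  x-nonNeg : .{{NonZero g₁}} → ∀ j → 0ℤ ℤ.≤ x j
  x-nonNeg j with minimum-attained x
  ... | μ , x[μ]≤x with step-to μ
  ... | p , stepμ = ℤ.≤-trans (ℤ.*-cancelˡ-≤-pos 0ℤ (x μ) (+ g₁) {{g₁-positive}} (+-cancelʳ-≤ (x μ) (begin
    + g₁ * 0ℤ + x μ   ≡⟨ cong (_+ x μ) (ℤ.*-zeroʳ (+ g₁)) ⟩
    0ℤ + x μ          ≡⟨ ℤ.+-comm 0ℤ (x μ) ⟩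
    x μ + 0ℤ          ≤⟨ ℤ.+-mono-≤ (x[μ]≤x p) (IsDigit⇒0≤ (digits p)) ⟩
    x p + l p         ≡⟨ stepμ ⟨
    + suc g₁ * x μ    ≡⟨ +[1+g₁]*-split (x μ) ⟩
    + g₁ * x μ + x μ  ∎))) (x[μ]≤x j)
    where
    open ℤ.≤-Reasoning
    g₁-positive : ℤ.Positive (+ g₁)
    g₁-positive = ℤ.positive (ℤ.+<+ (ℕ.>-nonZero⁻¹ g₁))

  x≡g^t*x : ∀ t j → ∃ λ i → x i ≡ + (suc g₁ ^ t) * x j mod m
  x≡g^t*x zero    j = j , ≡⇒≡mod (sym (ℤ.*-identityˡ (x j)))
  x≡g^t*x (suc t) j with x≡g^t*x t j
  ... | i , xᵢ≡ with step-to i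
  ... | p , stepᵢ = p , xₚ≡
    where
    open ≡mod-Reasoning m
    xₚ≡ : x p ≡ + (suc g₁ ^ suc t) * x j mod m
    xₚ≡ = begin
      x p                                ∼⟨ ≡mod-sym (+-multiple-≡mod (x p) (IsDigit⇒∣ (digits p))) ⟩
      x p + l p                          ≡⟨ stepᵢ ⟨
      + suc g₁ * x i                     ∼⟨ *-congˡ-≡mod (+ suc g₁) xᵢ≡ ⟩
      + suc g₁ * (+ (suc g₁ ^ t) * x j)  ≡⟨ ℤ.*-assoc (+ suc g₁) (+ (suc g₁ ^ t)) (x j) ⟨
      + suc g₁ * + (suc g₁ ^ t) * x j    ≡⟨ cong (_* x j) (ℤ.pos-* (suc g₁) (suc g₁ ^ t)) ⟨
      + (suc g₁ ^ suc t) * x j           ∎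

  InG⇒x≡a*x : ∀ a → InG (suc g₁) m a → ∀ j → ∃ λ i → x i ≡ a * x j mod m
  InG⇒x≡a*x a a∈G j with InG⇒≡mod a a∈G
  ... | t , g^t≡a with x≡g^t*x t j
  ... | i , xᵢ≡ = i , ≡mod-trans xᵢ≡ (*-congʳ-≡mod (x j) g^t≡a)

  g₁*x<m : ¬ g₁ ∣ m → ∀ j → + g₁ * x j ℤ.< + m
  g₁*x<m g₁∤m j = ℤ.≤∧≢⇒< (g₁*x≤m j) λ g₁xⱼ≡m →
    g₁∤m (ℤ.∣⇒∣ᵤ (ℤ.divides (x j) (trans (sym g₁xⱼ≡m) (ℤ.*-comm (+ g₁) (x j)))))

  no-positive⇒trivial : .{{NonZero g₁}} → (∀ j → ¬ (0ℤ ℤ.< x j)) → Trivial C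
  no-positive⇒trivial no-positive j = ℤ.≤-antisym (ℤ.≮⇒≥ (no-positive j)) (x-nonNeg j)

  neg∈G⇒no-positive : .{{NonZero g₁}} → ¬ g₁ ∣ m → ∀ {k} → 1 ≤ k → k < g₁ →
                      InG (suc g₁) m (- + k) → ∀ j → ¬ (0ℤ ℤ.< x j)
  neg∈G⇒no-positive g₁∤m {k} 1≤k k<g₁ -k∈G j 0<xⱼ with InG⇒x≡a*x (- + k) -k∈G j
  ... | i , ≡mod m∣d = ℤ.<⇒≱ d<m (∣∧pos⇒≤ m∣d 0<d)
    where
    open ℤ.≤-Reasoning
    d : ℤ
    d = x i - - + k * x j

    d≡ : ∀ a c b → a - - c * b ≡ a + c * b
    d≡ = solve-∀

    0<d : 0ℤ ℤ.< d
    0<d = begin-strict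
      0ℤ              ≡⟨ ℤ.*-zeroʳ (+ k) ⟨
      + k * 0ℤ        <⟨ ℤ.*-monoˡ-<-pos (+ k) {{ℤ.positive (ℤ.+<+ 1≤k)}} 0<xⱼ ⟩
      + k * x j       ≤⟨ ℤ.i≤j+i (+ k * x j) (x i) {{ℤ.nonNegative (x-nonNeg i)}} ⟩
      x i + + k * x j ≡⟨ d≡ (x i) (+ k) (x j) ⟨
      d               ∎

    expand : ∀ g a c b → g * (a - - c * b) ≡ g * a + c * (g * b)
    expand = solve-∀

    collect : ∀ c n → n + c * n ≡ (+ 1 + c) * n
    collect = solve-∀

    d<m : d ℤ.< + m
    d<m = ℤ.*-cancelˡ-<-nonNeg (+ g₁) (begin-strict
      + g₁ * d                        ≡⟨ expand (+ g₁) (x i) (+ k) (x j) ⟩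
      + g₁ * x i + + k * (+ g₁ * x j) <⟨ ℤ.+-mono-<-≤ (g₁*x<m g₁∤m i) (ℤ.*-monoˡ-≤-nonNeg (+ k) (g₁*x≤m j)) ⟩
      + m + + k * + m                 ≡⟨ collect (+ k) (+ m) ⟩
      (+ 1 + + k) * + m               ≤⟨ ℤ.*-monoʳ-≤-nonNeg (+ m) (ℤ.+≤+ k<g₁) ⟩
      + g₁ * + m                      ∎)

  pos∈G⇒no-positive : .{{NonZero g₁}} → ¬ g₁ ∣ m → ∀ {k} → 2 ≤ k → k ≤ g₁ →
                      InG (suc g₁) m (+ k) → ∀ j → ¬ (0ℤ ℤ.< x j)
  pos∈G⇒no-positive g₁∤m {k} 2≤k k≤g₁ k∈G j 0<xⱼ with maximum-attained x
  ... | M , x≤x[M] with InG⇒x≡a*x (+ k) k∈G M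
  ... | i , xᵢ≡kx[M] with ≡mod-sym xᵢ≡kx[M]
  ... | ≡mod m∣d = ℤ.<⇒≱ d<m (∣∧pos⇒≤ m∣d 0<d)
    where
    open ℤ.≤-Reasoning
    0<x[M] : 0ℤ ℤ.< x M
    0<x[M] = ℤ.<-≤-trans 0<xⱼ (x≤x[M] j)

    xᵢ<kx[M] : x i ℤ.< + k * x M
    xᵢ<kx[M] = begin-strict
      x i        ≤⟨ x≤x[M] i ⟩
      x M        ≡⟨ ℤ.*-identityˡ (x M) ⟨
      + 1 * x M  <⟨ ℤ.*-monoʳ-<-pos (x M) {{ℤ.positive 0<x[M]}} (ℤ.+<+ 2≤k) ⟩
      + k * x M  ∎

    0<d : 0ℤ ℤ.< + k * x M - x i
    0<d = begin-strict
      0ℤ              ≡⟨ ℤ.+-inverseʳ (x i) ⟨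
      x i - x i       <⟨ ℤ.+-monoˡ-< (- x i) xᵢ<kx[M] ⟩
      + k * x M - x i ∎

    d<m : + k * x M - x i ℤ.< + m
    d<m = begin-strict
      + k * x M - x i  ≤⟨ ℤ.i-j≤i (+ k * x M) (x i) {{ℤ.nonNegative (x-nonNeg i)}} ⟩
      + k * x M        ≤⟨ ℤ.*-monoʳ-≤-nonNeg (x M) {{ℤ.nonNegative (x-nonNeg M)}} (ℤ.+≤+ k≤g₁) ⟩
      + g₁ * x M       <⟨ g₁*x<m g₁∤m M ⟩
      + m              ∎

theorem2p12 : (g m : ℕ) → 4 ≤ g → 2 ∣ g → ¬ (2 ∣ m) → g ∸ 1 < m → ¬ ((g ∸ 1) ∣ m)
    → (∃ λ k → (1 ≤ k × k ≤ g ∸ 2) × InG g m (- (+ k)))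
      ⊎ (∃ λ k → (2 ≤ k × k ≤ g ∸ 1) × InG g m (+ k))
    → Complete g m
theorem2p12 (suc (suc g₂)) m (ℕ.s≤s (ℕ.s≤s _)) _ _ _ g₁∤m (inj₁ (k , (1≤k , k≤g₂) , -k∈G)) C =
  no-positive⇒trivial C (neg∈G⇒no-positive C g₁∤m 1≤k (ℕ.s≤s k≤g₂) -k∈G)
theorem2p12 (suc (suc g₂)) m (ℕ.s≤s (ℕ.s≤s _)) _ _ _ g₁∤m (inj₂ (k , (2≤k , k≤g₁) , k∈G)) C =
  no-positive⇒trivial C (pos∈G⇒no-positive C g₁∤m 2≤k k≤g₁ k∈G)
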